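{- Let $b$ be a nonzero rational number such that $b-1$ and $b^2-1$ are both squares of rational numbers (i.e., $\{1,b\}$ is a strong rational $D(-1)$-pair). Then there exist infinitely many rational numbers $c$ such that $\{1,b,c\}$ is a strong rational $D(-1)$-triple, i.e., $1,b,c$ are distinct nonzero rationals and $b-1$, $c-1$, $bc-1$, $b^2-1$, $c^2-1$ are all squares of rational numbers.
   Context: A strong rational $D(-1)$-pair is a set $\{a_1,a_2\}$ of two distinct nonzero rationals such that $a_1a_2-1$, $a_1^2-1$ and $a_2^2-1$ are all squares of rational numbers; a strong rational $D(-1)$-triple is a set of three distinct nonzero rationals $\{a_1,a_2,a_3\}$ such that $a_ia_j-1$ is a square of a rational number for all $1\le i\le j\le 3$ (including $i=j$). -}

module Defs where

open import Data.Rational using (ℚ; _*_; _-_; 1ℚ; 0ℚ)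
open import Data.Product using (∃; _×_)
open import Data.List using (List)
open import Data.List.Membership.Propositional using (_∉_)
open import Relation.Binary.PropositionalEquality using (_≡_; _≢_)

IsSquare : ℚ → Set
IsSquare q = ∃ λ r → r * r ≡ q

StrongD-1Pair : ℚ → ℚ → Set
StrongD-1Pair a₁ a₂ =
  a₁ ≢ 0ℚ × a₂ ≢ 0ℚ × a₁ ≢ a₂ ×
  IsSquare (a₁ * a₂ - 1ℚ) × IsSquare (a₁ * a₁ - 1ℚ) × IsSquare (a₂ * a₂ - 1ℚ)

StrongD-1Triple : ℚ → ℚ → ℚ → Set
StrongD-1Triple a₁ a₂ a₃ =
  a₁ ≢ 0ℚ × a₂ ≢ 0ℚ × a₃ ≢ 0ℚ ×
  a₁ ≢ a₂ × a₁ ≢ a₃ × a₂ ≢ a₃ ×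
  IsSquare (a₁ * a₁ - 1ℚ) × IsSquare (a₂ * a₂ - 1ℚ) × IsSquare (a₃ * a₃ - 1ℚ) ×
  IsSquare (a₁ * a₂ - 1ℚ) × IsSquare (a₁ * a₃ - 1ℚ) × IsSquare (a₂ * a₃ - 1ℚ)

InfinitelyMany : (ℚ → Set) → Set
InfinitelyMany P = (l : List ℚ) → ∃ λ c → c ∉ l × P c

-- Since b - 1 and b² - 1 are squares, b = (m⁴ + 4n⁴) / (4m²n²) with m odd and n ≠ 0.
-- Put N = m⁴ + 4n⁴, e₁ = N m², e₂ = -e₁, e₃ = e₁ / b = 4m⁴n² and x = e₁ c. Then
-- c - 1, c + 1 and b c - 1 are squares iff x - e₁ and x - e₂ lie in e₁ ℚ² and x - e₃ lies in ℚ², and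
-- these classes are those of the point B with x(B) = e₁ b on E : y² = (x - e₁)(x - e₂)(x - e₃).
-- By 2-descent they are also the classes of P + B for every P ∈ 2E(ℚ); concretely, the chord through
-- P = 2^(k+2) B and B gives an explicit square root of each of (x(P + B) - eᵢ)(x(B) - eᵢ)(x(P) - eᵢ),
-- and x(P) - eᵢ is a square because P is a double. So c_k = x(2^(k+2) B + B) / e₁ completes {1, b}.
-- In weighted coordinates the Z-coordinate of 2^k B is 2n u with u of 2-adic valuation exactly k,
-- and c_k = (x(B) + u ω / ε²) / e₁ with u ω / ε² of valuation exactly k + 3; this makes the c_k
-- pairwise distinct and different from 0, 1 and b.

module Submission where

open import Defs
open import Level using (0ℓ)
open import Data.Nat as ℕ using (ℕ; zero; suc; s≤s; z≤n)
import Data.Nat.Properties as ℕ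
open import Data.Nat.Coprimality using (recompute)
open import Data.Integer as ℤ using (ℤ; +_; 0ℤ; 1ℤ; _^_)
import Data.Integer.Properties as ℤ
open import Data.Integer.DivMod using (_%ℕ_; _/ℕ_; a≡a%ℕn+[a/ℕn]*n; n%ℕd<d)
open import Data.Integer.Divisibility.Signed
  using (_∣_; divides; ∣-trans; ∣m⇒∣-m; ∣n⇒∣m*n; ∣m⇒∣m*n; ∣⇒∣ᵤ)
import Data.Integer.Tactic.RingSolver as ℤ-RingSolver
open import Data.Rational as ℚ using (ℚ; mkℚ; 0ℚ; 1ℚ; _/_; 1/_)
import Data.Rational.Properties as ℚ
open import Data.Rational.Unnormalised as ℚᵘ using (mkℚᵘ; *≡*)
import Data.Rational.Unnormalised.Properties as ℚᵘ
open import Data.List using (List; []; _∷_)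
open import Data.List.Relation.Unary.Any using (here; there)
open import Data.List.Membership.Propositional using (_∉_)
open import Relation.Nullary.Decidable using (dec⇒maybe)
open import Data.Product using (∃; ∃₂; _×_; _,_)
open import Data.Sum using (_⊎_; inj₁; inj₂)
open import Data.Empty using (⊥-elim)
open import Relation.Nullary using (¬_; yes; no)
open import Relation.Binary.PropositionalEquality
open import Tactic.RingSolver.Core.AlmostCommutativeRing using (AlmostCommutativeRing; fromCommutativeRing)
open import Tactic.RingSolver.Core.Expression using (Expr; Κ; _⊕_; _⊗_; ⊝_)
import Tactic.RingSolver.NonReflective as NonReflective

-- Ring arithmetic is written with instance-overloaded operators, so that one polynomial expression
-- denotes an integer, a rational or a solver term; a polynomial identity is then proved by giving
-- its own statement, with ≐ for ≡, to the solver.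

record RingOps (A : Set) : Set where
  infixl 6 _+_
  infixl 7 _*_
  infix  8 -_ #_
  field
    _+_ _*_ : A → A → A
    -_      : A → A
    #_      : ℕ → A

open RingOps {{...}} public

instance
  ℤ-ops : RingOps ℤ
  ℤ-ops = record { _+_ = ℤ._+_ ; _*_ = ℤ._*_ ; -_ = ℤ.-_ ; #_ = +_ }

  ℚ-ops : RingOps ℚ
  ℚ-ops = record { _+_ = ℚ._+_ ; _*_ = ℚ._*_ ; -_ = ℚ.-_ ; #_ = λ k → + k / 1 }

  expr-ops : ∀ {A n} {{_ : RingOps A}} → RingOps (Expr A n)
  expr-ops = record { _+_ = _⊕_ ; _*_ = _⊗_ ; -_ = ⊝_ ; #_ = λ k → Κ (# k) }

module _ {A : Set} {{_ : RingOps A}} where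
  infixl 6 _-_
  _-_ : A → A → A
  x - y = x + - y

  sq cube : A → A
  sq x = x * x
  cube x = x * x * x

infix 4 _≐_
_≐_ : ∀ {A : Set} {n} → Expr A n → Expr A n → Expr A n × Expr A n
_≐_ = _,_

ℚ-ring : AlmostCommutativeRing 0ℓ 0ℓ
ℚ-ring = fromCommutativeRing ℚ.+-*-commutativeRing (λ x → dec⇒maybe (0ℚ ℚ.≟ x))

open NonReflective ℤ-RingSolver.ring using () renaming (solve to solveℤ)
open NonReflective ℚ-ring using () renaming (solve to solveℚ)

-- 2-adic valuations

Odd : ℤ → Set
Odd x = ∃ λ k → x ≡ # 1 + # 2 * k

2^_ : ℕ → ℤ
2^ e = (+ 2) ^ e

-- For d = 2^ e, d ∥ x says that x has 2-adic valuation exactly e.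
infix 4 _∥_

record _∥_ (d x : ℤ) : Set where
  constructor exactly
  field
    cofactor      : ℤ
    odd-cofactor  : Odd cofactor
    factorisation : x ≡ d * cofactor

odd-* : ∀ {a b} → Odd a → Odd b → Odd (a * b)
odd-* (k , refl) (l , refl) = k + l + # 2 * k * l ,
  solveℤ 2 (λ k l → (# 1 + # 2 * k) * (# 1 + # 2 * l) ≐ # 1 + # 2 * (k + l + # 2 * k * l)) refl k l

odd-+ : ∀ {a b} → Odd a → + 2 ∣ b → Odd (a + b)
odd-+ (k , refl) (divides q refl) = k + q ,
  solveℤ 2 (λ k q → # 1 + # 2 * k + q * # 2 ≐ # 1 + # 2 * (k + q)) refl k q

odd-neg : ∀ {a} → Odd a → Odd (- a)
odd-neg (k , refl) = - # 1 - k ,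
  solveℤ 1 (λ k → - (# 1 + # 2 * k) ≐ # 1 + # 2 * (- # 1 - k)) refl k

odd-- : ∀ {a b} → Odd a → + 2 ∣ b → Odd (a - b)
odd-- odd-a 2∣b = odd-+ odd-a (∣m⇒∣-m 2∣b)

odd⇒¬even : ∀ {a} → Odd a → ¬ (+ 2 ∣ a)
odd⇒¬even (k , refl) (divides q eq) = 1≢y*2 (q - k) (begin
  # 1                      ≡⟨ solveℤ 1 (λ k → # 1 ≐ # 1 + # 2 * k - # 2 * k) refl k ⟩
  # 1 + # 2 * k - # 2 * k  ≡⟨ cong (_- # 2 * k) eq ⟩
  q * # 2 - # 2 * k        ≡⟨ solveℤ 2 (λ k q → q * # 2 - # 2 * k ≐ (q - k) * # 2) refl k q ⟩
  (q - k) * # 2            ∎)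
  where
  open ≡-Reasoning
  1≢y*2 : ∀ y → # 1 ≢ y * # 2
  1≢y*2 (+ zero)   ()
  1≢y*2 (+ suc n)  eq = ℕ.0≢1+n (ℕ.suc-injective (ℤ.+-injective (trans eq (ℤ.pos-* (suc n) 2))))
  1≢y*2 ℤ.-[1+ n ] ()

odd⇒≢0 : ∀ {a} → Odd a → a ≢ 0ℤ
odd⇒≢0 odd-a refl = odd⇒¬even odd-a (divides 0ℤ refl)

odd⊎even : ∀ a → Odd a ⊎ + 2 ∣ a
odd⊎even a = by-remainder (a %ℕ 2) (n%ℕd<d a 2) (a≡a%ℕn+[a/ℕn]*n a 2)
  where
  by-remainder : ∀ r → r ℕ.< 2 → a ≡ + r + (a /ℕ 2) * # 2 → Odd a ⊎ + 2 ∣ a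
  by-remainder 0 _ eq = inj₂ (divides (a /ℕ 2) (trans eq (ℤ.+-identityˡ _)))
  by-remainder 1 _ eq = inj₁ (a /ℕ 2 , trans eq (cong (λ t → # 1 + t) (ℤ.*-comm (a /ℕ 2) (+ 2))))
  by-remainder (suc (suc r)) (s≤s (s≤s ()))

2^-+ : ∀ a b → 2^ (a ℕ.+ b) ≡ 2^ a * 2^ b
2^-+ = ℤ.^-distribˡ-+-* (+ 2)

2^≢0 : ∀ e → 2^ e ≢ 0ℤ
2^≢0 e 2^e≡0 with ℤ.i^n≡0⇒i≡0 (+ 2) e 2^e≡0
... | ()

2^-mono-∣ : ∀ {a b} → a ℕ.≤ b → 2^ a ∣ 2^ b
2^-mono-∣ {a} {b} a≤b = divides (2^ (b ℕ.∸ a)) (trans (cong 2^_ (sym (ℕ.m∸n+n≡m a≤b))) (2^-+ (b ℕ.∸ a) a))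

odd⇒∥ : ∀ {a} → Odd a → 2^ 0 ∥ a
odd⇒∥ {a} odd-a = exactly a odd-a (sym (ℤ.*-identityˡ a))

∥⇒∣ : ∀ {d x} → d ∥ x → d ∣ x
∥⇒∣ {d} (exactly o _ eq) = divides o (trans eq (ℤ.*-comm d o))

∥⇒≢0 : ∀ {d x} → d ≢ 0ℤ → d ∥ x → x ≢ 0ℤ
∥⇒≢0 {d} d≢0 (exactly o odd-o eq) refl =
  odd⇒≢0 odd-o (ℤ.*-cancelˡ-≡ d o 0ℤ {{ℤ.≢-nonZero d≢0}} (trans (sym eq) (sym (ℤ.*-zeroʳ d))))

∥-* : ∀ {a b x y} → 2^ a ∥ x → 2^ b ∥ y → 2^ (a ℕ.+ b) ∥ x * y
∥-* {a} {b} (exactly o odd-o refl) (exactly o′ odd-o′ refl) = exactly (o * o′) (odd-* odd-o odd-o′) (begin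
  2^ a * o * (2^ b * o′)   ≡⟨ solveℤ 4 (λ p o q o′ → p * o * (q * o′) ≐ p * q * (o * o′)) refl (2^ a) o (2^ b) o′ ⟩
  2^ a * 2^ b * (o * o′)   ≡⟨ cong (_* (o * o′)) (2^-+ a b) ⟨
  2^ (a ℕ.+ b) * (o * o′)  ∎)
  where open ≡-Reasoning

∥-+ : ∀ {d x y} → d ∥ x → + 2 * d ∣ y → d ∥ x + y
∥-+ {d} (exactly o odd-o refl) (divides q refl) = exactly (o + q * # 2) (odd-+ odd-o (divides q refl))
  (solveℤ 3 (λ d o q → d * o + q * (# 2 * d) ≐ d * (o + q * # 2)) refl d o q)

∥-neg : ∀ {d x} → d ∥ x → d ∥ - x
∥-neg {d} (exactly o odd-o refl) = exactly (- o) (odd-neg odd-o) (ℤ.neg-distribʳ-* d o)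

∥-double : ∀ {k u y} → Odd y → 2^ k ∥ u → 2^ suc k ∥ # 2 * y * u
∥-double {k} {y = y} odd-y (exactly o odd-o refl) = exactly (y * o) (odd-* odd-y odd-o)
  (solveℤ 3 (λ y p o → # 2 * y * (p * o) ≐ # 2 * p * (y * o)) refl y (2^ k) o)

∥-unique : ∀ a b {x} → 2^ a ∥ x → 2^ b ∥ x → a ≡ b
∥-unique zero    zero    _ _ = refl
∥-unique zero    (suc b) (exactly o odd-o eq) 2^b+1∥x =
  ⊥-elim (odd⇒¬even odd-o (∣-trans (2^-mono-∣ {1} {suc b} (s≤s z≤n)) 2^b+1∣o))
  where
  2^b+1∣o : 2^ suc b ∣ o
  2^b+1∣o = subst (2^ suc b ∣_) (trans eq (ℤ.*-identityˡ o)) (∥⇒∣ 2^b+1∥x)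
∥-unique (suc a) zero    2^a+1∥x 2^0∥x = sym (∥-unique zero (suc a) 2^0∥x 2^a+1∥x)
∥-unique (suc a) (suc b) (exactly o odd-o eq) (exactly o′ odd-o′ eq′) =
  cong suc (∥-unique a b (exactly o odd-o refl) (exactly o′ odd-o′ (ℤ.*-cancelˡ-≡ (+ 2) _ _ (begin
    + 2 * (2^ a * o)   ≡⟨ ℤ.*-assoc (+ 2) (2^ a) o ⟨
    2^ suc a * o       ≡⟨ trans (sym eq) eq′ ⟩
    2^ suc b * o′      ≡⟨ ℤ.*-assoc (+ 2) (2^ b) o′ ⟩
    + 2 * (2^ b * o′)  ∎))))
  where open ≡-Reasoning

even-2* : ∀ x → + 2 ∣ # 2 * x
even-2* x = ∣m⇒∣m*n x (divides 1ℤ refl)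

even-sq : ∀ {x} → + 2 ∣ x → + 2 ∣ sq x
even-sq {x} 2∣x = ∣m⇒∣m*n x 2∣x

*≢0 : ∀ {a b : ℤ} → a ≢ 0ℤ → b ≢ 0ℤ → a * b ≢ 0ℤ
*≢0 {a} a≢0 b≢0 ab≡0 with ℤ.i*j≡0⇒i≡0∨j≡0 a ab≡0
... | inj₁ a≡0 = a≢0 a≡0
... | inj₂ b≡0 = b≢0 b≡0

ι : ℤ → ℚ
ι a = a / 1

private
  ι≃ : ∀ a → ℚ.toℚᵘ (ι a) ℚᵘ.≃ mkℚᵘ a 0
  ι≃ a = ℚ.toℚᵘ-fromℚᵘ (mkℚᵘ a 0)

ι-+ : ∀ a b → ι (a + b) ≡ ι a + ι b
ι-+ a b = ℚ.toℚᵘ-injective (ℚᵘ.≃-trans (ι≃ (a + b)) (ℚᵘ.≃-sym (ℚᵘ.≃-trans (ℚ.toℚᵘ-homo-+ (ι a) (ι b))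
  (ℚᵘ.≃-trans (ℚᵘ.+-cong (ι≃ a) (ι≃ b))
    (*≡* (solveℤ 2 (λ a b → (a * # 1 + b * # 1) * # 1 ≐ (a + b) * # 1) refl a b))))))

ι-* : ∀ a b → ι (a * b) ≡ ι a * ι b
ι-* a b = ℚ.toℚᵘ-injective (ℚᵘ.≃-trans (ι≃ (a * b)) (ℚᵘ.≃-sym (ℚᵘ.≃-trans (ℚ.toℚᵘ-homo-* (ι a) (ι b))
  (ℚᵘ.≃-trans (ℚᵘ.*-cong (ι≃ a) (ι≃ b)) (*≡* refl)))))

ι-- : ∀ a b → ι (a - b) ≡ ι a - ι b
ι-- a b = trans (ι-+ a (- b)) (cong (λ x → ι a + x) (ℚ.toℚᵘ-injective (ℚᵘ.≃-trans (ι≃ (- b))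
  (ℚᵘ.≃-sym (ℚᵘ.≃-trans (ℚ.toℚᵘ-homo‿- (ι b)) (ℚᵘ.≃-trans (ℚᵘ.-‿cong (ι≃ b)) (*≡* refl)))))))

ι-injective : ∀ {a b} → ι a ≡ ι b → a ≡ b
ι-injective {a} {b} eq with ℚ.fromℚᵘ-injective {mkℚᵘ a 0} {mkℚᵘ b 0} eq
... | *≡* a*1≡b*1 = trans (sym (ℤ.*-identityʳ a)) (trans a*1≡b*1 (ℤ.*-identityʳ b))

ι≢0 : ∀ {d} → d ≢ 0ℤ → ι d ≢ 0ℚ
ι≢0 d≢0 eq = d≢0 (ι-injective eq)

ι-denominator : ∀ q → q * ι (ℚ.↧ q) ≡ ι (ℚ.↥ q)
ι-denominator q@(mkℚ a d _) = ℚ.toℚᵘ-injective (ℚᵘ.≃-trans (ℚ.toℚᵘ-homo-* q (ι (+ suc d)))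
  (ℚᵘ.≃-trans (ℚᵘ.*-cong (ℚᵘ.≃-refl {mkℚᵘ a d}) (ι≃ (+ suc d)))
    (ℚᵘ.≃-trans (*≡* (ℤ.*-assoc a (+ suc d) 1ℤ)) (ℚᵘ.≃-sym (ι≃ a)))))

-- frac a d d≢0 = a / d; d≢0 is used only irrelevantly, so any two proofs give the same rational.
frac : (a d : ℤ) → d ≢ 0ℤ → ℚ
frac a d d≢0 = ι a * (1/ ι d) {{ℚ.≢-nonZero (ι≢0 d≢0)}}

private
  inverse : ∀ {d} → d ≢ 0ℤ → ℚ
  inverse {d} d≢0 = (1/ ι d) {{ℚ.≢-nonZero (ι≢0 d≢0)}}

  inverse-spec : ∀ {d} (d≢0 : d ≢ 0ℤ) → ι d * inverse d≢0 ≡ 1ℚ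
  inverse-spec {d} d≢0 = ℚ.*-inverseʳ (ι d) {{ℚ.≢-nonZero (ι≢0 d≢0)}}

frac-spec : ∀ a d (d≢0 : d ≢ 0ℤ) → frac a d d≢0 * ι d ≡ ι a
frac-spec a d d≢0 = begin
  ι a * d⁻¹ * ι d    ≡⟨ solveℚ 3 (λ a i d → a * i * d ≐ a * (d * i)) refl (ι a) d⁻¹ (ι d) ⟩
  ι a * (ι d * d⁻¹)  ≡⟨ cong (ι a *_) (inverse-spec d≢0) ⟩
  ι a * 1ℚ           ≡⟨ ℚ.*-identityʳ (ι a) ⟩
  ι a                ∎
  where
  open ≡-Reasoning
  d⁻¹ = inverse d≢0

frac-unique : ∀ {q} a {d} (d≢0 : d ≢ 0ℤ) → q * ι d ≡ ι a → q ≡ frac a d d≢0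
frac-unique {q} a {d} d≢0 eq = begin
  q                  ≡⟨ ℚ.*-identityʳ q ⟨
  q * 1ℚ             ≡⟨ cong (q *_) (inverse-spec d≢0) ⟨
  q * (ι d * d⁻¹)    ≡⟨ ℚ.*-assoc q (ι d) d⁻¹ ⟨
  q * ι d * d⁻¹      ≡⟨ cong (_* d⁻¹) eq ⟩
  ι a * d⁻¹          ∎
  where
  open ≡-Reasoning
  d⁻¹ = inverse d≢0

frac-cross : ∀ a a′ {d d′} (d≢0 : d ≢ 0ℤ) (d′≢0 : d′ ≢ 0ℤ) →
             frac a d d≢0 ≡ frac a′ d′ d′≢0 → a * d′ ≡ a′ * d
frac-cross a a′ {d} {d′} d≢0 d′≢0 eq = ι-injective (begin
  ι (a * d′)        ≡⟨ ι-* a d′ ⟩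
  ι a * ι d′        ≡⟨ cong (_* ι d′) (frac-spec a d d≢0) ⟨
  q * ι d * ι d′    ≡⟨ cong (λ x → x * ι d * ι d′) eq ⟩
  q′ * ι d * ι d′   ≡⟨ solveℚ 3 (λ q x y → q * x * y ≐ q * y * x) refl q′ (ι d) (ι d′) ⟩
  q′ * ι d′ * ι d   ≡⟨ cong (_* ι d) (frac-spec a′ d′ d′≢0) ⟩
  ι a′ * ι d        ≡⟨ ι-* a′ d ⟨
  ι (a′ * d)        ∎)
  where
  open ≡-Reasoning
  q = frac a d d≢0
  q′ = frac a′ d′ d′≢0

frac-cong : ∀ a a′ {d d′} (d≢0 : d ≢ 0ℤ) (d′≢0 : d′ ≢ 0ℤ) →
            a * d′ ≡ a′ * d → frac a d d≢0 ≡ frac a′ d′ d′≢0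
frac-cong a a′ {d} {d′} d≢0 d′≢0 eq = frac-unique a′ d′≢0 (begin
  q * ι d′                ≡⟨ ℚ.*-identityʳ _ ⟨
  q * ι d′ * 1ℚ           ≡⟨ cong (q * ι d′ *_) (inverse-spec d≢0) ⟨
  q * ι d′ * (ι d * d⁻¹)  ≡⟨ solveℚ 4 (λ q x y i → q * x * (y * i) ≐ q * y * x * i) refl q (ι d′) (ι d) d⁻¹ ⟩
  q * ι d * ι d′ * d⁻¹    ≡⟨ cong (λ x → x * ι d′ * d⁻¹) (frac-spec a d d≢0) ⟩
  ι a * ι d′ * d⁻¹        ≡⟨ cong (_* d⁻¹) (trans (sym (ι-* a d′)) (trans (cong ι eq) (ι-* a′ d))) ⟩
  ι a′ * ι d * d⁻¹        ≡⟨ ℚ.*-assoc (ι a′) (ι d) d⁻¹ ⟩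
  ι a′ * (ι d * d⁻¹)      ≡⟨ cong (ι a′ *_) (inverse-spec d≢0) ⟩
  ι a′ * 1ℚ               ≡⟨ ℚ.*-identityʳ (ι a′) ⟩
  ι a′                    ∎)
  where
  open ≡-Reasoning
  q = frac a d d≢0
  d⁻¹ = inverse d≢0

frac-* : ∀ a d a′ d′ (d≢0 : d ≢ 0ℤ) (d′≢0 : d′ ≢ 0ℤ) →
         frac a d d≢0 * frac a′ d′ d′≢0 ≡ frac (a * a′) (d * d′) (*≢0 d≢0 d′≢0)
frac-* a d a′ d′ d≢0 d′≢0 = frac-unique (a * a′) (*≢0 d≢0 d′≢0) (begin
  q * q′ * ι (d * d′)      ≡⟨ cong (q * q′ *_) (ι-* d d′) ⟩
  q * q′ * (ι d * ι d′)    ≡⟨ solveℚ 4 (λ q q′ x y → q * q′ * (x * y) ≐ (q * x) * (q′ * y)) refl q q′ (ι d) (ι d′) ⟩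
  (q * ι d) * (q′ * ι d′)  ≡⟨ cong₂ _*_ (frac-spec a d d≢0) (frac-spec a′ d′ d′≢0) ⟩
  ι a * ι a′               ≡⟨ ι-* a a′ ⟨
  ι (a * a′)               ∎)
  where
  open ≡-Reasoning
  q = frac a d d≢0
  q′ = frac a′ d′ d′≢0

frac-+1 : ∀ a d (d≢0 : d ≢ 0ℤ) → frac a d d≢0 + 1ℚ ≡ frac (a + d) d d≢0
frac-+1 a d d≢0 = frac-unique (a + d) d≢0 (begin
  (q + 1ℚ) * ι d   ≡⟨ solveℚ 2 (λ q x → (q + Κ 1ℚ) * x ≐ q * x + x) refl q (ι d) ⟩
  q * ι d + ι d    ≡⟨ cong (_+ ι d) (frac-spec a d d≢0) ⟩
  ι a + ι d        ≡⟨ ι-+ a d ⟨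
  ι (a + d)        ∎)
  where
  open ≡-Reasoning
  q = frac a d d≢0

frac--1 : ∀ a d (d≢0 : d ≢ 0ℤ) → frac a d d≢0 - 1ℚ ≡ frac (a - d) d d≢0
frac--1 a d d≢0 = frac-unique (a - d) d≢0 (begin
  (q - 1ℚ) * ι d   ≡⟨ solveℚ 2 (λ q x → (q - Κ 1ℚ) * x ≐ q * x - x) refl q (ι d) ⟩
  q * ι d - ι d    ≡⟨ cong (_- ι d) (frac-spec a d d≢0) ⟩
  ι a - ι d        ≡⟨ ι-- a d ⟨
  ι (a - d)        ∎)
  where
  open ≡-Reasoning
  q = frac a d d≢0

frac-zero : ∀ {d} (d≢0 : d ≢ 0ℤ) → frac 0ℤ d d≢0 ≡ 0ℚ
frac-zero d≢0 = ℚ.*-zeroˡ (inverse d≢0)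

ι≡frac : ∀ a → ι a ≡ frac a 1ℤ (λ ())
ι≡frac a = frac-unique a {1ℤ} (λ ()) (ℚ.*-identityʳ (ι a))

isSquare-frac : ∀ {a d φ δ} (d≢0 : d ≢ 0ℤ) (δ≢0 : δ ≢ 0ℤ) →
                sq φ * d ≡ a * sq δ → IsSquare (frac a d d≢0)
isSquare-frac {a} {_} {φ} {δ} d≢0 δ≢0 eq =
  frac φ δ δ≢0 , trans (frac-* φ δ φ δ δ≢0 δ≢0) (frac-cong (sq φ) a (*≢0 δ≢0 δ≢0) d≢0 eq)

isSquare-* : ∀ {p q} → IsSquare p → IsSquare q → IsSquare (p * q)
isSquare-* (x , refl) (y , refl) = x * y , solveℚ 2 (λ x y → (x * y) * (x * y) ≐ x * x * (y * y)) refl x y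

-- The curves y² = (x - e)(x - f)(x - g) in weighted coordinates

record Point (A : Set) : Set where
  constructor ⟨_,_,_⟩
  field X Y Z : A

open Point

-- ⟨ X , Y , Z ⟩ stands for the affine point (X / Z², Y / Z³).
module _ {A : Set} {{_ : RingOps A}} where
  cubic : A → A → A → Point A → A
  cubic e f g P = (X P - e * sq (Z P)) * (X P - f * sq (Z P)) * (X P - g * sq (Z P))

  -- x(2P) - e = (τ e f g P / (2 Y Z))² for P on the curve.
  τ : A → A → A → Point A → A
  τ e f g P = sq (X P - e * sq (Z P)) - (e - f) * (e - g) * sq (sq (Z P))

  double : A → A → A → Point A → Point A
  double e f g P = ⟨ sq (τ e f g P) + e * sq Z′ , τ e f g P * τ f e g P * τ g e f P , Z′ ⟩
    where Z′ = # 2 * Y P * Z P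

  Δx Δy : Point A → Point A → A
  Δx P P₀ = X P * sq (Z P₀) - X P₀ * sq (Z P)
  Δy P P₀ = Y P * cube (Z P₀) - Y P₀ * cube (Z P)

  -- x(P + P₀) = chordNum s P P₀ / chordDen P P₀, where s = e + f + g.
  chordNum : A → Point A → Point A → A
  chordNum s P P₀ = sq (Δy P P₀) - (X P * sq (Z P₀) + X P₀ * sq (Z P) - s * sq (Z P) * sq (Z P₀)) * sq (Δx P P₀)

  chordDen : Point A → Point A → A
  chordDen P P₀ = sq (Z P) * sq (Z P₀) * sq (Δx P P₀)

  chordΦ : A → Point A → Point A → A
  chordΦ e P P₀ = Y P₀ * Z P * Δx P P₀ - Δy P P₀ * (X P₀ - e * sq (Z P₀))

  -- When Z P = u * Z P₀, the chord numerator is (Z P₀)⁶ u² (X P₀ ε² + u ω) on the curve.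
  ε : Point A → Point A → A → A
  ε P P₀ u = X P - X P₀ * sq u

  ω₁ : A → A → A → Point A → Point A → A → A
  ω₁ e f g P P₀ u =
    (# 3 * sq (X P₀) - # 2 * (e + f + g) * X P₀ * sq (Z P₀) + (e * f + e * g + f * g) * sq (sq (Z P₀))) * X P
    + ((e * f + e * g + f * g) * X P₀ * sq (sq (Z P₀)) - # 2 * (e * f * g) * sq (cube (Z P₀)) - cube (X P₀)) * sq u

  ω : A → A → A → Point A → Point A → A → A
  ω e f g P P₀ u = - (# 2 * Y P₀ * Y P) + u * ω₁ e f g P P₀ u

drop-defect : ∀ a K {d : ℤ} → d ≡ 0ℤ → a + K * d ≡ a
drop-defect a K refl = solveℤ 2 (λ a K → a + K * # 0 ≐ a) refl a K

drop-defects : ∀ a K K′ {d d′ : ℤ} → d ≡ 0ℤ → d′ ≡ 0ℤ → a + K * d + K′ * d′ ≡ a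
drop-defects a K K′ refl refl = solveℤ 3 (λ a K K′ → a + K * # 0 + K′ * # 0 ≐ a) refl a K K′

cubic-swap : ∀ e f g (P : Point ℤ) → cubic f e g P ≡ cubic e f g P
cubic-swap e f g ⟨ x , y , z ⟩ = solveℤ 6 (λ e f g x y z → let P = ⟨ x , y , z ⟩ in cubic f e g P ≐ cubic e f g P) refl e f g x y z

cubic-rotate : ∀ e f g (P : Point ℤ) → cubic g e f P ≡ cubic e f g P
cubic-rotate e f g ⟨ x , y , z ⟩ = solveℤ 6 (λ e f g x y z → let P = ⟨ x , y , z ⟩ in cubic g e f P ≐ cubic e f g P) refl e f g x y z

module WeierstrassCurve (e f g : ℤ) where

  OnCurve : Point ℤ → Set
  OnCurve P = sq (Y P) ≡ cubic e f g P

  defect≡0 : ∀ {P} → OnCurve P → cubic e f g P - sq (Y P) ≡ 0ℤ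
  defect≡0 {P} onC = trans (cong (λ t → cubic e f g P - t) onC) (ℤ.+-inverseʳ (cubic e f g P))

  double-sub₁ : ∀ P → let P′ = double e f g P in X P′ - e * sq (Z P′) ≡ sq (τ e f g P)
  double-sub₁ ⟨ x , y , z ⟩ = solveℤ 6 (λ e f g x y z → let P′ = double e f g ⟨ x , y , z ⟩ in
    X P′ - e * sq (Z P′) ≐ sq (τ e f g ⟨ x , y , z ⟩)) refl e f g x y z

  double-sub₂ : ∀ {P} → OnCurve P → let P′ = double e f g P in X P′ - f * sq (Z P′) ≡ sq (τ f e g P)
  double-sub₂ {P@(⟨ x , y , z ⟩)} onC =
    trans (identity e f g x y z) (drop-defect (sq (τ f e g P)) ((f - e) * (# 4 * sq z)) (defect≡0 {P} onC))
    where
    identity : ∀ e f g x y z → let P = ⟨ x , y , z ⟩; P′ = double e f g P in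
      X P′ - f * sq (Z P′) ≡ sq (τ f e g P) + (f - e) * (# 4 * sq z) * (cubic e f g P - sq y)
    identity = solveℤ 6 (λ e f g x y z → let P = ⟨ x , y , z ⟩; P′ = double e f g P in
      X P′ - f * sq (Z P′) ≐ sq (τ f e g P) + (f - e) * (# 4 * sq z) * (cubic e f g P - sq y)) refl

  double-sub₃ : ∀ {P} → OnCurve P → let P′ = double e f g P in X P′ - g * sq (Z P′) ≡ sq (τ g e f P)
  double-sub₃ {P@(⟨ x , y , z ⟩)} onC =
    trans (identity e f g x y z) (drop-defect (sq (τ g e f P)) ((g - e) * (# 4 * sq z)) (defect≡0 {P} onC))
    where
    identity : ∀ e f g x y z → let P = ⟨ x , y , z ⟩; P′ = double e f g P in
      X P′ - g * sq (Z P′) ≡ sq (τ g e f P) + (g - e) * (# 4 * sq z) * (cubic e f g P - sq y)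
    identity = solveℤ 6 (λ e f g x y z → let P = ⟨ x , y , z ⟩; P′ = double e f g P in
      X P′ - g * sq (Z P′) ≐ sq (τ g e f P) + (g - e) * (# 4 * sq z) * (cubic e f g P - sq y)) refl

  double-onCurve : ∀ {P} → OnCurve P → OnCurve (double e f g P)
  double-onCurve {P} onC = begin
    sq (τ₁ * τ₂ * τ₃)          ≡⟨ solveℤ 3 (λ a b c → sq (a * b * c) ≐ sq a * sq b * sq c) refl τ₁ τ₂ τ₃ ⟩
    sq τ₁ * sq τ₂ * sq τ₃      ≡⟨ cong₂ _*_ (cong₂ _*_ (double-sub₁ P) (double-sub₂ {P} onC)) (double-sub₃ {P} onC) ⟨
    cubic e f g (double e f g P)  ∎
    where
    open ≡-Reasoning
    τ₁ = τ e f g P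
    τ₂ = τ f e g P
    τ₃ = τ g e f P

  -- 2-descent: (x(P + P₀) - e)(x(P₀) - e)(x(P) - e) = (chordΦ e P P₀ / (Z P (Z P₀)⁴ Δx P P₀))².
  descent : ∀ {P P₀} → OnCurve P → OnCurve P₀ →
    (chordNum (e + f + g) P P₀ - e * chordDen P P₀) * (X P₀ - e * sq (Z P₀)) * (X P - e * sq (Z P)) * sq (Z P₀)
      ≡ sq (chordΦ e P P₀) * sq (Z P)
  descent {P@(⟨ x , y , z ⟩)} {P₀@(⟨ x₀ , y₀ , z₀ ⟩)} onC onC₀ =
    trans (identity e f g x y z x₀ y₀ z₀)
      (drop-defects (sq (chordΦ e P P₀) * sq z) (- (sq (cube z₀) * Δx P P₀ * (x₀ - e * sq z₀)))
                    (sq (sq z) * sq z₀ * Δx P P₀ * (x - e * sq z)) (defect≡0 {P} onC) (defect≡0 {P₀} onC₀))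
    where
    identity : ∀ e f g x y z x₀ y₀ z₀ → let P = ⟨ x , y , z ⟩; P₀ = ⟨ x₀ , y₀ , z₀ ⟩ in
      (chordNum (e + f + g) P P₀ - e * chordDen P P₀) * (x₀ - e * sq z₀) * (x - e * sq z) * sq z₀
        ≡ sq (chordΦ e P P₀) * sq z
          + (- (sq (cube z₀) * Δx P P₀ * (x₀ - e * sq z₀))) * (cubic e f g P - sq y)
          + sq (sq z) * sq z₀ * Δx P P₀ * (x - e * sq z) * (cubic e f g P₀ - sq y₀)
    identity = solveℤ 9 (λ e f g x y z x₀ y₀ z₀ → let P = ⟨ x , y , z ⟩; P₀ = ⟨ x₀ , y₀ , z₀ ⟩ in
      (chordNum (e + f + g) P P₀ - e * chordDen P P₀) * (x₀ - e * sq z₀) * (x - e * sq z) * sq z₀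
        ≐ sq (chordΦ e P P₀) * sq z
          + (- (sq (cube z₀) * Δx P P₀ * (x₀ - e * sq z₀))) * (cubic e f g P - sq y)
          + sq (sq z) * sq z₀ * Δx P P₀ * (x - e * sq z) * (cubic e f g P₀ - sq y₀)) refl

  chordNum-factor : ∀ {P P₀} u → OnCurve P → OnCurve P₀ → Z P ≡ u * Z P₀ →
    chordNum (e + f + g) P P₀ ≡ sq (cube (Z P₀)) * sq u * (X P₀ * sq (ε P P₀ u) + u * ω e f g P P₀ u)
  chordNum-factor {P@(⟨ x , y , _ ⟩)} {P₀@(⟨ x₀ , y₀ , z₀ ⟩)} u onC onC₀ refl =
    trans (identity e f g x y u x₀ y₀ z₀)
      (drop-defects (sq (cube z₀) * sq u * (x₀ * sq (ε P P₀ u) + u * ω e f g P P₀ u)) (- sq (cube z₀))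
                    (- sq (cube (u * z₀))) (defect≡0 {P} onC) (defect≡0 {P₀} onC₀))
    where
    identity : ∀ e f g x y u x₀ y₀ z₀ → let P = ⟨ x , y , u * z₀ ⟩; P₀ = ⟨ x₀ , y₀ , z₀ ⟩ in
      chordNum (e + f + g) P P₀
        ≡ sq (cube z₀) * sq u * (x₀ * sq (ε P P₀ u) + u * ω e f g P P₀ u)
          + (- sq (cube z₀)) * (cubic e f g P - sq y)
          + (- sq (cube (u * z₀))) * (cubic e f g P₀ - sq y₀)
    identity = solveℤ 9 (λ e f g x y u x₀ y₀ z₀ → let P = ⟨ x , y , u * z₀ ⟩; P₀ = ⟨ x₀ , y₀ , z₀ ⟩ in
      chordNum (e + f + g) P P₀
        ≐ sq (cube z₀) * sq u * (x₀ * sq (ε P P₀ u) + u * ω e f g P P₀ u)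
          + (- sq (cube z₀)) * (cubic e f g P - sq y)
          + (- sq (cube (u * z₀))) * (cubic e f g P₀ - sq y₀)) refl

Δx-factor : ∀ (P P₀ : Point ℤ) u → Z P ≡ u * Z P₀ → Δx P P₀ ≡ sq (Z P₀) * ε P P₀ u
Δx-factor ⟨ x , _ , _ ⟩ ⟨ x₀ , _ , z₀ ⟩ u refl =
  solveℤ 4 (λ x u x₀ z₀ → x * sq z₀ - x₀ * sq (u * z₀) ≐ sq z₀ * (x - x₀ * sq u)) refl x u x₀ z₀

-- The curve attached to b = bNum m n / bDen m n

module _ {A : Set} {{_ : RingOps A}} where
  bNum bDen : A → A → A
  bNum m n = sq (sq m) + # 4 * sq (sq n)
  bDen m n = # 4 * sq m * sq n

-- N is kept a parameter, which keeps the solver problems below small; only B-sub₁₂₃ need N = bNum m n.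
module Parameters {A : Set} {{_ : RingOps A}} (N m n : A) where
  e₁ e₂ e₃ κ₁ κ₂ : A
  e₁ = N * sq m
  e₂ = - e₁
  e₃ = # 4 * sq n * sq (sq m)
  κ₁ = sq m - # 2 * sq n
  κ₂ = sq m + # 2 * sq n

  B : Point A
  B = ⟨ sq N , N * (sq N - # 16 * sq (sq m) * sq (sq n)) , # 2 * n ⟩

B-onCurve : ∀ N m n → let open Parameters N m n in sq (Y B) ≡ cubic e₁ e₂ e₃ B
B-onCurve = solveℤ 3 (λ N m n → let open Parameters N m n in sq (Y B) ≐ cubic e₁ e₂ e₃ B) refl

B-sub₁ : ∀ m n → let open Parameters (bNum m n) m n in X B - e₁ * sq (Z B) ≡ bNum m n * sq κ₁
B-sub₁ m n = trans (solveℤ 3 (λ N m n → let open Parameters N m n in X B - e₁ * sq (Z B) ≐ N * (N - bDen m n)) refl (bNum m n) m n)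
  (cong (bNum m n *_) (solveℤ 2 (λ m n → let open Parameters (bNum m n) m n in bNum m n - bDen m n ≐ sq κ₁) refl m n))

B-sub₂ : ∀ m n → let open Parameters (bNum m n) m n in X B - e₂ * sq (Z B) ≡ bNum m n * sq κ₂
B-sub₂ m n = trans (solveℤ 3 (λ N m n → let open Parameters N m n in X B - e₂ * sq (Z B) ≐ N * (N + bDen m n)) refl (bNum m n) m n)
  (cong (bNum m n *_) (solveℤ 2 (λ m n → let open Parameters (bNum m n) m n in bNum m n + bDen m n ≐ sq κ₂) refl m n))

B-sub₃ : ∀ m n → let open Parameters (bNum m n) m n in X B - e₃ * sq (Z B) ≡ sq (κ₁ * κ₂)
B-sub₃ m n = trans (solveℤ 3 (λ N m n → let open Parameters N m n in X B - e₃ * sq (Z B) ≐ (N - bDen m n) * (N + bDen m n)) refl (bNum m n) m n)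
  (solveℤ 2 (λ m n → let open Parameters (bNum m n) m n in (bNum m n - bDen m n) * (bNum m n + bDen m n) ≐ sq (κ₁ * κ₂)) refl m n)

bDen*e₁≡N*e₃ : ∀ N m n → let open Parameters N m n in bDen m n * e₁ ≡ N * e₃
bDen*e₁≡N*e₃ = solveℤ 3 (λ N m n → let open Parameters N m n in bDen m n * e₁ ≐ N * e₃) refl

N*e₁*Z²≡X*bDen : ∀ N m n → let open Parameters N m n in N * (e₁ * sq (Z B)) ≡ X B * bDen m n
N*e₁*Z²≡X*bDen = solveℤ 3 (λ N m n → let open Parameters N m n in N * (e₁ * sq (Z B)) ≐ X B * bDen m n) refl

τ-odd : ∀ e f g {P : Point ℤ} → Odd (X P) → + 2 ∣ Z P → Odd (τ e f g P)
τ-odd e f g {P} odd-X 2∣Z = odd-- (odd-* odd-X-eZ² odd-X-eZ²) (∣n⇒∣m*n ((e - f) * (e - g)) (even-sq (even-sq 2∣Z)))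
  where
  odd-X-eZ² : Odd (X P - e * sq (Z P))
  odd-X-eZ² = odd-- odd-X (∣n⇒∣m*n e (even-sq 2∣Z))

descent-square : ∀ {a β ρ γ T z Z Δ Φ : ℤ} → β * ρ ≡ sq γ → a * β * sq T * sq z ≡ sq Φ * sq Z →
                 sq Φ * (ρ * (sq Z * sq z * sq Δ)) ≡ a * sq (γ * T * sq z * Δ)
descent-square {a} {β} {ρ} {γ} {T} {z} {Z} {Δ} {Φ} βρ≡γ² descent = begin
  sq Φ * (ρ * (sq Z * sq z * sq Δ))      ≡⟨ solveℤ 5 (λ Φ ρ Z z Δ → sq Φ * (ρ * (sq Z * sq z * sq Δ)) ≐ sq Φ * sq Z * (ρ * sq z * sq Δ)) refl Φ ρ Z z Δ ⟩
  sq Φ * sq Z * (ρ * sq z * sq Δ)        ≡⟨ cong (_* (ρ * sq z * sq Δ)) descent ⟨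
  a * β * sq T * sq z * (ρ * sq z * sq Δ) ≡⟨ solveℤ 6 (λ a β ρ T z Δ → a * β * sq T * sq z * (ρ * sq z * sq Δ) ≐ a * (β * ρ) * sq (T * sq z * Δ)) refl a β ρ T z Δ ⟩
  a * (β * ρ) * sq (T * sq z * Δ)        ≡⟨ cong (λ t → a * t * sq (T * sq z * Δ)) βρ≡γ² ⟩
  a * sq γ * sq (T * sq z * Δ)           ≡⟨ solveℤ 5 (λ a γ T z Δ → a * sq γ * sq (T * sq z * Δ) ≐ a * sq (γ * T * sq z * Δ)) refl a γ T z Δ ⟩
  a * sq (γ * T * sq z * Δ)              ∎
  where open ≡-Reasoning

cross-cancel : ∀ {x₀ K aᵢ aⱼ εᵢ εⱼ : ℤ} → K ≢ 0ℤ →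
               (x₀ * sq εᵢ + aᵢ) * (K * sq εⱼ) ≡ (x₀ * sq εⱼ + aⱼ) * (K * sq εᵢ) → aᵢ * sq εⱼ ≡ aⱼ * sq εᵢ
cross-cancel {x₀} {K} {aᵢ} {aⱼ} {εᵢ} {εⱼ} K≢0 eq = begin
  aᵢ * sq εⱼ                        ≡⟨ solveℤ 4 (λ x₀ aᵢ εᵢ εⱼ → aᵢ * sq εⱼ ≐ x₀ * sq εᵢ * sq εⱼ + aᵢ * sq εⱼ - x₀ * sq εᵢ * sq εⱼ) refl x₀ aᵢ εᵢ εⱼ ⟩
  x₀ * sq εᵢ * sq εⱼ + aᵢ * sq εⱼ - c  ≡⟨ cong (_- c) (ℤ.*-cancelˡ-≡ K _ _ {{ℤ.≢-nonZero K≢0}} (begin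
    K * (c + aᵢ * sq εⱼ)                 ≡⟨ solveℤ 5 (λ x₀ K aᵢ εᵢ εⱼ → K * (x₀ * sq εᵢ * sq εⱼ + aᵢ * sq εⱼ) ≐ (x₀ * sq εᵢ + aᵢ) * (K * sq εⱼ)) refl x₀ K aᵢ εᵢ εⱼ ⟩
    (x₀ * sq εᵢ + aᵢ) * (K * sq εⱼ)      ≡⟨ eq ⟩
    (x₀ * sq εⱼ + aⱼ) * (K * sq εᵢ)      ≡⟨ solveℤ 5 (λ x₀ K aⱼ εᵢ εⱼ → (x₀ * sq εⱼ + aⱼ) * (K * sq εᵢ) ≐ K * (x₀ * sq εᵢ * sq εⱼ + aⱼ * sq εᵢ)) refl x₀ K aⱼ εᵢ εⱼ ⟩
    K * (c + aⱼ * sq εᵢ)                 ∎)) ⟩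
  c + aⱼ * sq εᵢ - c                   ≡⟨ solveℤ 2 (λ c a → c + a - c ≐ a) refl c (aⱼ * sq εᵢ) ⟩
  aⱼ * sq εᵢ                          ∎
  where
  open ≡-Reasoning
  c = x₀ * sq εᵢ * sq εⱼ

module Construction (m n : ℤ) (m-odd : Odd m) (n≢0 : n ≢ 0ℤ) where

  N D : ℤ
  N = bNum m n
  D = bDen m n

  open Parameters N m n public
  open WeierstrassCurve e₁ e₂ e₃

  z₀ : ℤ
  z₀ = Z B

  odd-m² : Odd (sq m)
  odd-m² = odd-* m-odd m-odd

  odd-N : Odd N
  odd-N = odd-+ (odd-* odd-m² odd-m²) (∣m⇒∣m*n (sq (sq n)) (divides (+ 2) refl))

  odd-κ₁ : Odd κ₁
  odd-κ₁ = odd-- odd-m² (even-2* (sq n))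

  odd-κ₂ : Odd κ₂
  odd-κ₂ = odd-+ odd-m² (even-2* (sq n))

  odd-XB : Odd (X B)
  odd-XB = odd-* odd-N odd-N

  odd-YB : Odd (Y B)
  odd-YB = odd-* odd-N (odd-- odd-XB (∣m⇒∣m*n (sq (sq n)) (∣m⇒∣m*n (sq (sq m)) (divides (+ 8) refl))))

  e₁≢0 : e₁ ≢ 0ℤ
  e₁≢0 = odd⇒≢0 (odd-* odd-N odd-m²)

  z₀≢0 : z₀ ≢ 0ℤ
  z₀≢0 = *≢0 {+ 2} (λ ()) n≢0

  D≢0 : D ≢ 0ℤ
  D≢0 = *≢0 (*≢0 {+ 4} (λ ()) (odd⇒≢0 odd-m²)) (*≢0 n≢0 n≢0)

  record Invariant (k : ℕ) (P : Point ℤ) : Set where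
    field
      on-curve : OnCurve P
      odd-X    : Odd (X P)
      odd-Y    : Odd (Y P)
      scale    : ℤ
      scale∥   : 2^ k ∥ scale
      Z≡scale  : Z P ≡ scale * z₀

    even-Z : + 2 ∣ Z P
    even-Z = subst (+ 2 ∣_) (sym Z≡scale) (∣n⇒∣m*n scale (even-2* n))

  invariant-double : ∀ {k P} → Invariant k P → Invariant (suc k) (double e₁ e₂ e₃ P)
  invariant-double {k} {P} inv = record
    { on-curve = double-onCurve {P} on-curve
    ; odd-X    = odd-+ (odd-* (odd-τ e₁ e₂ e₃) (odd-τ e₁ e₂ e₃)) (∣n⇒∣m*n e₁ (even-sq (∣m⇒∣m*n (Z P) (even-2* (Y P)))))
    ; odd-Y    = odd-* (odd-* (odd-τ e₁ e₂ e₃) (odd-τ e₂ e₁ e₃)) (odd-τ e₃ e₁ e₂)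
    ; scale    = # 2 * Y P * scale
    ; scale∥   = ∥-double {k} odd-Y scale∥
    ; Z≡scale  = trans (cong (# 2 * Y P *_) Z≡scale) (sym (ℤ.*-assoc (# 2 * Y P) scale z₀))
    }
    where
    open Invariant inv
    odd-τ : ∀ e f g → Odd (τ e f g P)
    odd-τ e f g = τ-odd e f g {P} odd-X even-Z

  opaque
    doubled : ℕ → Point ℤ
    doubled zero    = B
    doubled (suc k) = double e₁ e₂ e₃ (doubled k)

    doubled-suc : ∀ k → doubled (suc k) ≡ double e₁ e₂ e₃ (doubled k)
    doubled-suc k = refl

    invariant : ∀ k → Invariant k (doubled k)
    invariant zero    = record
      { on-curve = B-onCurve N m n ; odd-X = odd-XB ; odd-Y = odd-YB
      ; scale = 1ℤ ; scale∥ = odd⇒∥ (0ℤ , refl) ; Z≡scale = sym (ℤ.*-identityˡ z₀) }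
    invariant (suc k) = invariant-double (invariant k)

  -- Step k defines c = x(P + B) / e₁ for P = 2^(k+2) B; starting from k + 2 makes 4 ∣ u, hence 2 ∥ ω.
  module Step (k : ℕ) where

    Q P : Point ℤ
    Q = doubled (suc k)
    P = doubled (suc (suc k))

    private
      module IQ = Invariant (invariant (suc k))
      module IP = Invariant (invariant (suc (suc k)))

    u εₖ ωₖ W Num Den : ℤ
    u   = IP.scale
    εₖ  = ε P B u
    ωₖ  = ω e₁ e₂ e₃ P B u
    W   = X B * sq εₖ + u * ωₖ
    Num = chordNum (e₁ + e₂ + e₃) P B
    Den = chordDen P B

    2∣u : + 2 ∣ u
    2∣u = ∣-trans (2^-mono-∣ {1} {suc (suc k)} (s≤s z≤n)) (∥⇒∣ IP.scale∥)

    4∣u : + 4 ∣ u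
    4∣u = ∣-trans (2^-mono-∣ {2} {suc (suc k)} (s≤s (s≤s z≤n))) (∥⇒∣ IP.scale∥)

    odd-ε : Odd εₖ
    odd-ε = odd-- IP.odd-X (∣n⇒∣m*n (X B) (∣m⇒∣m*n u 2∣u))

    ω∥ : 2^ 1 ∥ ωₖ
    ω∥ = ∥-+ (∥-neg 2Y₀Y∥) (∣m⇒∣m*n (ω₁ e₁ e₂ e₃ P B u) 4∣u)
      where
      2Y₀Y∥ : 2^ 1 ∥ # 2 * Y B * Y P
      2Y₀Y∥ = exactly (Y B * Y P) (odd-* odd-YB IP.odd-Y) (ℤ.*-assoc (+ 2) (Y B) (Y P))

    u≢0 : u ≢ 0ℤ
    u≢0 = ∥⇒≢0 {2^ suc (suc k)} (2^≢0 (suc (suc k))) IP.scale∥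

    ω≢0 : ωₖ ≢ 0ℤ
    ω≢0 = ∥⇒≢0 {2^ 1} (2^≢0 1) ω∥

    uωε²∥ : ∀ {ε′} → Odd ε′ → 2^ (suc (suc k) ℕ.+ 1 ℕ.+ 0) ∥ u * ωₖ * sq ε′
    uωε²∥ odd-ε′ = ∥-* {suc (suc k) ℕ.+ 1} {0} (∥-* {suc (suc k)} {1} IP.scale∥ ω∥) (odd⇒∥ (odd-* odd-ε′ odd-ε′))

    Δx≡ : Δx P B ≡ sq z₀ * εₖ
    Δx≡ = Δx-factor P B u IP.Z≡scale

    Δx≢0 : Δx P B ≢ 0ℤ
    Δx≢0 eq = *≢0 (*≢0 z₀≢0 z₀≢0) (odd⇒≢0 odd-ε) (trans (sym Δx≡) eq)

    Den≢0 : Den ≢ 0ℤ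
    Den≢0 = *≢0 (*≢0 (*≢0 ZP≢0 ZP≢0) (*≢0 z₀≢0 z₀≢0)) (*≢0 Δx≢0 Δx≢0)
      where
      ZP≢0 : Z P ≢ 0ℤ
      ZP≢0 eq = *≢0 u≢0 z₀≢0 (trans (sym IP.Z≡scale) eq)

    e₁Den≢0 : e₁ * Den ≢ 0ℤ
    e₁Den≢0 = *≢0 e₁≢0 Den≢0

    c : ℚ
    c = frac Num (e₁ * Den) e₁Den≢0

    d≢0 : e₁ * sq z₀ * sq εₖ ≢ 0ℤ
    d≢0 = *≢0 (*≢0 e₁≢0 (*≢0 z₀≢0 z₀≢0)) (*≢0 (odd⇒≢0 odd-ε) (odd⇒≢0 odd-ε))

    c-reduced : c ≡ frac W (e₁ * sq z₀ * sq εₖ) d≢0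
    c-reduced = frac-cong Num W e₁Den≢0 d≢0 (begin
      Num * (e₁ * sq z₀ * sq εₖ)
        ≡⟨ cong (_* (e₁ * sq z₀ * sq εₖ)) (chordNum-factor {P} {B} u IP.on-curve (B-onCurve N m n) IP.Z≡scale) ⟩
      sq (cube z₀) * sq u * W * (e₁ * sq z₀ * sq εₖ)
        ≡⟨ solveℤ 5 (λ z u W e ε → sq (cube z) * sq u * W * (e * sq z * sq ε) ≐ W * (e * (sq (u * z) * sq z * sq (sq z * ε)))) refl z₀ u W e₁ εₖ ⟩
      W * (e₁ * (sq (u * z₀) * sq z₀ * sq (sq z₀ * εₖ)))
        ≡⟨ cong₂ (λ Z Δ → W * (e₁ * (sq Z * sq z₀ * sq Δ))) IP.Z≡scale Δx≡ ⟨
      W * (e₁ * Den)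
        ∎)
      where open ≡-Reasoning

    odd-W : Odd W
    odd-W = odd-+ (odd-* odd-XB (odd-* odd-ε odd-ε)) (∣m⇒∣m*n ωₖ 2∣u)

    odd-W-d : Odd (W - e₁ * sq z₀ * sq εₖ)
    odd-W-d = subst Odd (sym W-d≡) (odd-+ (odd-* (odd-* odd-N (odd-* odd-κ₁ odd-κ₁)) (odd-* odd-ε odd-ε)) (∣m⇒∣m*n ωₖ 2∣u))
      where
      W-d≡ : W - e₁ * sq z₀ * sq εₖ ≡ N * sq κ₁ * sq εₖ + u * ωₖ
      W-d≡ = trans (solveℤ 6 (λ x₀ ε u ω e z → x₀ * sq ε + u * ω - e * sq z * sq ε ≐ (x₀ - e * sq z) * sq ε + u * ω) refl (X B) εₖ u ωₖ e₁ z₀)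
                   (cong (λ t → t * sq εₖ + u * ωₖ) (B-sub₁ m n))

    c≢0 : c ≢ 0ℚ
    c≢0 c≡0 = odd⇒≢0 odd-W (begin
      W              ≡⟨ ℤ.*-identityʳ W ⟨
      W * 1ℤ         ≡⟨ frac-cross W 0ℤ d≢0 (λ ()) (trans (sym c-reduced) (trans c≡0 (ι≡frac 0ℤ))) ⟩
      0ℤ * (e₁ * sq z₀ * sq εₖ)  ≡⟨ ℤ.*-zeroˡ (e₁ * sq z₀ * sq εₖ) ⟩
      0ℤ             ∎)
      where open ≡-Reasoning

    1≢c : 1ℚ ≢ c
    1≢c 1≡c = odd⇒≢0 odd-W-d (begin
      W - d          ≡⟨ cong (_- d) (trans (sym (ℤ.*-identityʳ W)) (frac-cross W 1ℤ d≢0 (λ ()) (trans (sym c-reduced) (trans (sym 1≡c) (ι≡frac 1ℤ))))) ⟩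
      1ℤ * d - d     ≡⟨ cong (_- d) (ℤ.*-identityˡ d) ⟩
      d - d          ≡⟨ ℤ.+-inverseʳ d ⟩
      0ℤ             ∎)
      where
      open ≡-Reasoning
      d = e₁ * sq z₀ * sq εₖ

    b≢c : ∀ {b} → b ≡ frac N D D≢0 → b ≢ c
    b≢c refl b≡c = *≢0 (*≢0 u≢0 ω≢0) D≢0 (begin
      u * ωₖ * D                          ≡⟨ solveℤ 5 (λ x₀ ε u ω D → u * ω * D ≐ (x₀ * sq ε + u * ω) * D - x₀ * D * sq ε) refl (X B) εₖ u ωₖ D ⟩
      W * D - X B * D * sq εₖ             ≡⟨ cong (λ t → W * D - t * sq εₖ) (N*e₁*Z²≡X*bDen N m n) ⟨
      W * D - N * (e₁ * sq z₀) * sq εₖ    ≡⟨ cong (λ t → W * D - t) (ℤ.*-assoc N (e₁ * sq z₀) (sq εₖ)) ⟩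
      W * D - N * (e₁ * sq z₀ * sq εₖ)    ≡⟨ cong (λ t → W * D - t) (frac-cross N W D≢0 d≢0 (trans b≡c c-reduced)) ⟩
      W * D - W * D                       ≡⟨ ℤ.+-inverseʳ (W * D) ⟩
      0ℤ                                  ∎)
      where open ≡-Reasoning

    odd-T : ∀ e f g → Odd (τ e f g Q)
    odd-T e f g = τ-odd e f g {Q} IQ.odd-X IQ.even-Z

    P≡2Q : P ≡ double e₁ e₂ e₃ Q
    P≡2Q = doubled-suc (suc k)

    sub₁ : X P - e₁ * sq (Z P) ≡ sq (τ e₁ e₂ e₃ Q)
    sub₁ = subst (λ R → X R - e₁ * sq (Z R) ≡ sq (τ e₁ e₂ e₃ Q)) (sym P≡2Q) (double-sub₁ Q)

    sub₂ : X P - e₂ * sq (Z P) ≡ sq (τ e₂ e₁ e₃ Q)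
    sub₂ = subst (λ R → X R - e₂ * sq (Z R) ≡ sq (τ e₂ e₁ e₃ Q)) (sym P≡2Q) (double-sub₂ {Q} IQ.on-curve)

    sub₃ : X P - e₃ * sq (Z P) ≡ sq (τ e₃ e₁ e₂ Q)
    sub₃ = subst (λ R → X R - e₃ * sq (Z R) ≡ sq (τ e₃ e₁ e₂ Q)) (sym P≡2Q) (double-sub₃ {Q} IQ.on-curve)

    Descent : ℤ → Set
    Descent r = ∃ λ Φ → (Num - r * Den) * (X B - r * sq z₀) * (X P - r * sq (Z P)) * sq z₀ ≡ sq Φ * sq (Z P)

    descent₁ : Descent e₁
    descent₁ = chordΦ e₁ P B , descent {P} {B} IP.on-curve (B-onCurve N m n)

    -- The roots e₂ and e₃ are handled by reading the same curve with its roots listed in another order.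

    descent₂ : Descent e₂
    descent₂ = chordΦ e₂ P B , subst (λ s → (chordNum s P B - e₂ * Den) * (X B - e₂ * sq z₀) * (X P - e₂ * sq (Z P)) * sq z₀ ≡ sq (chordΦ e₂ P B) * sq (Z P))
      (solveℤ 3 (λ e f g → f + e + g ≐ e + f + g) refl e₁ e₂ e₃)
      (C₂.descent {P} {B} (trans IP.on-curve (sym (cubic-swap e₁ e₂ e₃ P))) (trans (B-onCurve N m n) (sym (cubic-swap e₁ e₂ e₃ B))))
      where module C₂ = WeierstrassCurve e₂ e₁ e₃

    descent₃ : Descent e₃
    descent₃ = chordΦ e₃ P B , subst (λ s → (chordNum s P B - e₃ * Den) * (X B - e₃ * sq z₀) * (X P - e₃ * sq (Z P)) * sq z₀ ≡ sq (chordΦ e₃ P B) * sq (Z P))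
      (solveℤ 3 (λ e f g → g + e + f ≐ e + f + g) refl e₁ e₂ e₃)
      (C₃.descent {P} {B} (trans IP.on-curve (sym (cubic-rotate e₁ e₂ e₃ P))) (trans (B-onCurve N m n) (sym (cubic-rotate e₁ e₂ e₃ B))))
      where module C₃ = WeierstrassCurve e₃ e₁ e₂

    chord-square : ∀ r β ρ γ T (ρDen≢0 : ρ * Den ≢ 0ℤ) → γ ≢ 0ℤ → Odd T → Descent r →
                   X B - r * sq z₀ ≡ β → X P - r * sq (Z P) ≡ sq T → β * ρ ≡ sq γ →
                   IsSquare (frac (Num - r * Den) (ρ * Den) ρDen≢0)
    chord-square r β ρ γ T ρDen≢0 γ≢0 odd-T (Φ , descent-r) sub-B sub-P βρ≡γ² =
      isSquare-frac {Num - r * Den} {ρ * Den} {Φ} {γ * T * sq z₀ * Δx P B} ρDen≢0 δ≢0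
        (descent-square {Num - r * Den} {β} {ρ} {γ} {T} {z₀} {Z P} {Δx P B} {Φ} βρ≡γ²
          (subst₂ (λ b t → (Num - r * Den) * b * t * sq z₀ ≡ sq Φ * sq (Z P)) sub-B sub-P descent-r))
      where
      δ≢0 : γ * T * sq z₀ * Δx P B ≢ 0ℤ
      δ≢0 = *≢0 (*≢0 (*≢0 γ≢0 (odd⇒≢0 odd-T)) (*≢0 z₀≢0 z₀≢0)) Δx≢0

    c-1-square : IsSquare (c - 1ℚ)
    c-1-square = subst IsSquare (sym (frac--1 Num (e₁ * Den) e₁Den≢0))
      (chord-square e₁ (N * sq κ₁) e₁ (N * m * κ₁) (τ e₁ e₂ e₃ Q) e₁Den≢0 (odd⇒≢0 (odd-* (odd-* odd-N m-odd) odd-κ₁)) (odd-T e₁ e₂ e₃) descent₁ (B-sub₁ m n) sub₁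
        (solveℤ 3 (λ N m κ → N * sq κ * (N * sq m) ≐ sq (N * m * κ)) refl N m κ₁))

    c+1-square : IsSquare (c + 1ℚ)
    c+1-square = subst IsSquare (sym (trans (frac-+1 Num (e₁ * Den) e₁Den≢0) (cong (λ a → frac a (e₁ * Den) e₁Den≢0) Num+e₁Den≡)))
      (chord-square e₂ (N * sq κ₂) e₁ (N * m * κ₂) (τ e₂ e₁ e₃ Q) e₁Den≢0 (odd⇒≢0 (odd-* (odd-* odd-N m-odd) odd-κ₂)) (odd-T e₂ e₁ e₃) descent₂ (B-sub₂ m n) sub₂
        (solveℤ 3 (λ N m κ → N * sq κ * (N * sq m) ≐ sq (N * m * κ)) refl N m κ₂))
      where
      Num+e₁Den≡ : Num + e₁ * Den ≡ Num - e₂ * Den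
      Num+e₁Den≡ = solveℤ 3 (λ a e d → a + e * d ≐ a - (- e) * d) refl Num e₁ Den

    bc-1-square : ∀ {b} → b ≡ frac N D D≢0 → IsSquare (b * c - 1ℚ)
    bc-1-square refl = subst IsSquare (sym bc-1≡)
      (chord-square e₃ (sq (κ₁ * κ₂)) e₃ (# 2 * n * sq m * κ₁ * κ₂) (τ e₃ e₁ e₂ Q) e₃Den≢0 γ≢0 (odd-T e₃ e₁ e₂) descent₃ (B-sub₃ m n) sub₃
        (solveℤ 4 (λ m n κ₁ κ₂ → sq (κ₁ * κ₂) * (# 4 * sq n * sq (sq m)) ≐ sq (# 2 * n * sq m * κ₁ * κ₂)) refl m n κ₁ κ₂))
      where
      e₃Den≢0 : e₃ * Den ≢ 0ℤ
      e₃Den≢0 = *≢0 (*≢0 (*≢0 {+ 4} (λ ()) (*≢0 n≢0 n≢0)) (odd⇒≢0 (odd-* odd-m² odd-m²))) Den≢0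
      γ≢0 : # 2 * n * sq m * κ₁ * κ₂ ≢ 0ℤ
      γ≢0 = *≢0 (*≢0 (*≢0 (*≢0 {+ 2} (λ ()) n≢0) (odd⇒≢0 odd-m²)) (odd⇒≢0 odd-κ₁)) (odd⇒≢0 odd-κ₂)
      DDen≢0 : D * (e₁ * Den) ≢ 0ℤ
      DDen≢0 = *≢0 D≢0 e₁Den≢0
      h : D * e₁ ≡ N * e₃
      h = bDen*e₁≡N*e₃ N m n
      bc-1≡ : frac N D D≢0 * c - 1ℚ ≡ frac (Num - e₃ * Den) (e₃ * Den) e₃Den≢0
      bc-1≡ = begin
        frac N D D≢0 * c - 1ℚ                         ≡⟨ cong (_- 1ℚ) (frac-* N D Num (e₁ * Den) D≢0 e₁Den≢0) ⟩
        frac (N * Num) (D * (e₁ * Den)) DDen≢0 - 1ℚ   ≡⟨ frac--1 (N * Num) (D * (e₁ * Den)) DDen≢0 ⟩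
        frac (N * Num - D * (e₁ * Den)) (D * (e₁ * Den)) DDen≢0
          ≡⟨ frac-cong (N * Num - D * (e₁ * Den)) (Num - e₃ * Den) DDen≢0 e₃Den≢0 (begin
            (N * Num - D * (e₁ * Den)) * (e₃ * Den)
              ≡⟨ solveℤ 6 (λ N a D e f d → (N * a - D * (e * d)) * (f * d) ≐ (N * a - (D * e) * d) * (f * d)) refl N Num D e₁ e₃ Den ⟩
            (N * Num - (D * e₁) * Den) * (e₃ * Den)
              ≡⟨ cong (λ t → (N * Num - t * Den) * (e₃ * Den)) h ⟩
            (N * Num - (N * e₃) * Den) * (e₃ * Den)
              ≡⟨ solveℤ 4 (λ N a f d → (N * a - (N * f) * d) * (f * d) ≐ (a - f * d) * ((N * f) * d)) refl N Num e₃ Den ⟩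
            (Num - e₃ * Den) * ((N * e₃) * Den)
              ≡⟨ cong (λ t → (Num - e₃ * Den) * (t * Den)) h ⟨
            (Num - e₃ * Den) * ((D * e₁) * Den)
              ≡⟨ cong ((Num - e₃ * Den) *_) (ℤ.*-assoc D e₁ Den) ⟩
            (Num - e₃ * Den) * (D * (e₁ * Den))  ∎) ⟩
        frac (Num - e₃ * Den) (e₃ * Den) e₃Den≢0       ∎
        where open ≡-Reasoning

    c²-1-square : IsSquare (c * c - 1ℚ)
    c²-1-square = subst IsSquare (solveℚ 1 (λ c → (c - Κ 1ℚ) * (c + Κ 1ℚ) ≐ c * c - Κ 1ℚ) refl c)
      (isSquare-* c-1-square c+1-square)

  c : ℕ → ℚ
  c k = Step.c k

  c-injective : ∀ {i j} → c i ≡ c j → i ≡ j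
  c-injective {i} {j} cᵢ≡cⱼ = ℕ.suc-injective (ℕ.suc-injective (ℕ.+-cancelʳ-≡ 1 _ _
    (trans (sym (ℕ.+-identityʳ _)) (trans valuations (ℕ.+-identityʳ _)))))
    where
    module Sᵢ = Step i
    module Sⱼ = Step j
    -- c = (X₀ ε² + u ω) / (e₁ z₀² ε²), so cᵢ = cⱼ forces uᵢ ωᵢ εⱼ² = uⱼ ωⱼ εᵢ², whose 2-adic valuations are i + 3 and j + 3.
    uωε²≡ : Sᵢ.u * Sᵢ.ωₖ * sq Sⱼ.εₖ ≡ Sⱼ.u * Sⱼ.ωₖ * sq Sᵢ.εₖ
    uωε²≡ = cross-cancel {X B} {e₁ * sq z₀} {Sᵢ.u * Sᵢ.ωₖ} {Sⱼ.u * Sⱼ.ωₖ} {Sᵢ.εₖ} {Sⱼ.εₖ} (*≢0 e₁≢0 (*≢0 z₀≢0 z₀≢0))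
      (frac-cross Sᵢ.W Sⱼ.W Sᵢ.d≢0 Sⱼ.d≢0 (trans (sym Sᵢ.c-reduced) (trans cᵢ≡cⱼ Sⱼ.c-reduced)))
    valuations : suc (suc i) ℕ.+ 1 ℕ.+ 0 ≡ suc (suc j) ℕ.+ 1 ℕ.+ 0
    valuations = ∥-unique _ _ (Sᵢ.uωε²∥ Sⱼ.odd-ε) (subst (2^ (suc (suc j) ℕ.+ 1 ℕ.+ 0) ∥_) (sym uωε²≡) (Sⱼ.uωε²∥ Sᵢ.odd-ε))

  triple : ∀ {b} → b ≡ frac N D D≢0 → b ≢ 0ℚ → 1ℚ ≢ b → IsSquare (1ℚ * b - 1ℚ) → IsSquare (b * b - 1ℚ) →
           ∀ k → StrongD-1Triple 1ℚ b (c k)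
  triple b≡N/D b≢0 1≢b 1b-1□ bb-1□ k =
    (λ ()) , b≢0 , S.c≢0 , 1≢b , S.1≢c , S.b≢c b≡N/D ,
    (0ℚ , refl) , bb-1□ , S.c²-1-square ,
    1b-1□ , subst (λ t → IsSquare (t - 1ℚ)) (sym (ℚ.*-identityˡ (c k))) S.c-1-square , S.bc-1-square b≡N/D
    where module S = Step k

-- From the pair {1, b} to the parametrisation of b

ℚ-cancelˡ : ∀ {a x y : ℚ} → a ≢ 0ℚ → a * x ≡ a * y → x ≡ y
ℚ-cancelˡ {a} {x} {y} a≢0 eq = begin
  x                ≡⟨ ℚ.*-identityˡ x ⟨
  1ℚ * x           ≡⟨ cong (_* x) (ℚ.*-inverseˡ a {{ℚ.≢-nonZero a≢0}}) ⟨
  a⁻¹ * a * x      ≡⟨ ℚ.*-assoc a⁻¹ a x ⟩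
  a⁻¹ * (a * x)    ≡⟨ cong (a⁻¹ *_) eq ⟩
  a⁻¹ * (a * y)    ≡⟨ ℚ.*-assoc a⁻¹ a y ⟨
  a⁻¹ * a * y      ≡⟨ cong (_* y) (ℚ.*-inverseˡ a {{ℚ.≢-nonZero a≢0}}) ⟩
  1ℚ * y           ≡⟨ ℚ.*-identityˡ y ⟩
  y                ∎
  where
  open ≡-Reasoning
  a⁻¹ = (1/ a) {{ℚ.≢-nonZero a≢0}}

-- b - 1 = s² and b² - 1 = r² give (r/s)² - s² = 2, so t = r/s - s satisfies 2 s t = 2 - t² and b = (t⁴ + 4) / (4 t²).
pair⇒quartic : ∀ {b s r : ℚ} → s * s ≡ 1ℚ * b - 1ℚ → r * r ≡ b * b - 1ℚ → 1ℚ ≢ b →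
               ∃ λ t → t ≢ 0ℚ × b * (# 4 * sq t) ≡ sq (sq t) + # 4
pair⇒quartic {b} {s} {r} s²≡b-1 r²≡b²-1 1≢b = t , t≢0 , quartic
  where
  open ≡-Reasoning
  b≡ : b ≡ sq s + 1ℚ
  b≡ = trans (solveℚ 1 (λ b → b ≐ Κ 1ℚ * b - Κ 1ℚ + Κ 1ℚ) refl b) (cong (_+ 1ℚ) (sym s²≡b-1))
  s≢0 : s ≢ 0ℚ
  s≢0 refl = 1≢b (sym b≡)
  s⁻¹ v t : ℚ
  s⁻¹ = (1/ s) {{ℚ.≢-nonZero s≢0}}
  v = r * s⁻¹
  t = v - s
  v²≡ : sq v ≡ sq s + # 2
  v²≡ = begin
    sq (r * s⁻¹)                                 ≡⟨ solveℚ 2 (λ r i → sq (r * i) ≐ r * r * sq i) refl r s⁻¹ ⟩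
    r * r * sq s⁻¹                               ≡⟨ cong (_* sq s⁻¹) (trans r²≡b²-1 (cong (λ x → x * x - 1ℚ) b≡)) ⟩
    ((sq s + 1ℚ) * (sq s + 1ℚ) - 1ℚ) * sq s⁻¹    ≡⟨ solveℚ 2 (λ s i → ((sq s + Κ 1ℚ) * (sq s + Κ 1ℚ) - Κ 1ℚ) * sq i ≐ sq (s * i) * (sq s + # 2)) refl s s⁻¹ ⟩
    sq (s * s⁻¹) * (sq s + # 2)                  ≡⟨ cong (λ x → sq x * (sq s + # 2)) (ℚ.*-inverseʳ s {{ℚ.≢-nonZero s≢0}}) ⟩
    sq 1ℚ * (sq s + # 2)                         ≡⟨ solveℚ 1 (λ s → sq (Κ 1ℚ) * (sq s + # 2) ≐ sq s + # 2) refl s ⟩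
    sq s + # 2                                   ∎
  t*[v+s]≡2 : t * (v + s) ≡ # 2
  t*[v+s]≡2 = begin
    (v - s) * (v + s)   ≡⟨ solveℚ 2 (λ v s → (v - s) * (v + s) ≐ sq v - sq s) refl v s ⟩
    sq v - sq s         ≡⟨ cong (_- sq s) v²≡ ⟩
    sq s + # 2 - sq s   ≡⟨ solveℚ 1 (λ s → sq s + # 2 - sq s ≐ # 2) refl s ⟩
    # 2                 ∎
  t≢0 : t ≢ 0ℚ
  t≢0 t≡0 = 2≢0 (trans (sym t*[v+s]≡2) (trans (cong (_* (v + s)) t≡0) (ℚ.*-zeroˡ (v + s))))
    where
    2≢0 : # 2 ≢ 0ℚ
    2≢0 ()
  quartic : b * (# 4 * sq t) ≡ sq (sq t) + # 4
  quartic = begin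
    b * (# 4 * sq t)                      ≡⟨ cong (_* (# 4 * sq t)) b≡ ⟩
    (sq s + 1ℚ) * (# 4 * sq (v - s))      ≡⟨ solveℚ 2 (λ v s → (sq s + Κ 1ℚ) * (# 4 * sq (v - s)) ≐ sq ((v - s) * (v + s) - sq (v - s)) + # 4 * sq (v - s)) refl v s ⟩
    sq (t * (v + s) - sq t) + # 4 * sq t  ≡⟨ cong (λ x → sq (x - sq t) + # 4 * sq t) t*[v+s]≡2 ⟩
    sq (# 2 - sq t) + # 4 * sq t          ≡⟨ solveℚ 1 (λ t → sq (# 2 - sq t) + # 4 * sq t ≐ sq (sq t) + # 4) refl t ⟩
    sq (sq t) + # 4                       ∎

quartic-scale : ∀ {b t p q : ℚ} → t * q ≡ p → b * (# 4 * sq t) ≡ sq (sq t) + # 4 → b * bDen p q ≡ bNum p q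
quartic-scale {b} {t} {q = q} refl quartic = begin
  b * bDen (t * q) q               ≡⟨ solveℚ 3 (λ b t q → b * bDen (t * q) q ≐ b * (# 4 * sq t) * sq (sq q)) refl b t q ⟩
  b * (# 4 * sq t) * sq (sq q)     ≡⟨ cong (_* sq (sq q)) quartic ⟩
  (sq (sq t) + # 4) * sq (sq q)    ≡⟨ solveℚ 2 (λ t q → (sq (sq t) + # 4) * sq (sq q) ≐ bNum (t * q) q) refl t q ⟩
  bNum (t * q) q                   ∎
  where open ≡-Reasoning

quartic-halve : ∀ {b p q : ℚ} → b * bDen (# 2 * p) q ≡ bNum (# 2 * p) q → b * bDen q p ≡ bNum q p
quartic-halve {b} {p} {q} eq = ℚ-cancelˡ {# 4} (λ ()) (begin
  # 4 * (b * bDen q p)    ≡⟨ solveℚ 3 (λ b p q → # 4 * (b * bDen q p) ≐ b * bDen (# 2 * p) q) refl b p q ⟩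
  b * bDen (# 2 * p) q    ≡⟨ eq ⟩
  bNum (# 2 * p) q        ≡⟨ solveℚ 2 (λ p q → bNum (# 2 * p) q ≐ # 4 * bNum q p) refl p q ⟩
  # 4 * bNum q p          ∎)
  where open ≡-Reasoning

ι-bDen : ∀ m n → ι (bDen m n) ≡ bDen (ι m) (ι n)
ι-bDen m n = trans (ι-* (# 4 * sq m) (sq n)) (cong₂ _*_ (trans (ι-* (# 4) (sq m)) (cong (# 4 *_) (ι-* m m))) (ι-* n n))

ι-bNum : ∀ m n → ι (bNum m n) ≡ bNum (ι m) (ι n)
ι-bNum m n = trans (ι-+ (sq (sq m)) (# 4 * sq (sq n))) (cong₂ _+_ (ι-sq² m) (trans (ι-* (# 4) (sq (sq n))) (cong (# 4 *_) (ι-sq² n))))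
  where
  ι-sq² : ∀ x → ι (sq (sq x)) ≡ sq (sq (ι x))
  ι-sq² x = trans (ι-* (sq x) (sq x)) (cong₂ _*_ (ι-* x x) (ι-* x x))

integral : ∀ {b} m n → b * bDen (ι m) (ι n) ≡ bNum (ι m) (ι n) → b * ι (bDen m n) ≡ ι (bNum m n)
integral {b} m n eq = trans (cong (b *_) (ι-bDen m n)) (trans eq (sym (ι-bNum m n)))

-- Writing t = p / q: if p is odd take (m, n) = (p, q); if p = 2 p′ then q is odd and (m, n) = (q, p′),
-- by the symmetry t ↦ 2 / t of (t⁴ + 4) / (4 t²).
fraction⇒integral : ∀ {b t : ℚ} {p q : ℤ} → t ≢ 0ℚ → q ≢ 0ℤ → ¬ (+ 2 ∣ p × + 2 ∣ q) → t * ι q ≡ ι p →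
                    b * (# 4 * sq t) ≡ sq (sq t) + # 4 → ∃₂ λ m n → Odd m × n ≢ 0ℤ × b * ι (bDen m n) ≡ ι (bNum m n)
fraction⇒integral {b} {t} {p} {q} t≢0 q≢0 coprime tq≡p quartic with odd⊎even p
... | inj₁ odd-p = p , q , odd-p , q≢0 , integral {b} p q (quartic-scale {b} {t} {ι p} {ι q} tq≡p quartic)
... | inj₂ (divides p′ p≡p′*2) with odd⊎even q
...   | inj₂ 2∣q  = ⊥-elim (coprime (divides p′ p≡p′*2 , 2∣q))
...   | inj₁ odd-q = q , p′ , odd-q , p′≢0 , integral {b} q p′ (quartic-halve {b} {ι p′} {ι q} (quartic-scale {b} {t} {# 2 * ι p′} {ι q} tq≡2p′ quartic))
  where
  tq≡2p′ : t * ι q ≡ # 2 * ι p′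
  tq≡2p′ = trans tq≡p (trans (cong ι p≡p′*2) (trans (ι-* p′ (+ 2)) (ℚ.*-comm (ι p′) (# 2))))
  p′≢0 : p′ ≢ 0ℤ
  p′≢0 p′≡0 = t≢0 (trans (frac-unique 0ℤ q≢0 (trans tq≡p (cong ι (trans p≡p′*2 (cong (_* + 2) p′≡0))))) (frac-zero q≢0))

quartic⇒integral : ∀ {b : ℚ} → (∃ λ t → t ≢ 0ℚ × b * (# 4 * sq t) ≡ sq (sq t) + # 4) →
                   ∃₂ λ m n → Odd m × n ≢ 0ℤ × b * ι (bDen m n) ≡ ι (bNum m n)
quartic⇒integral {b} (t , t≢0 , quartic) =
  fraction⇒integral {b} {t} {ℚ.↥ t} {ℚ.↧ t} t≢0 (λ ()) (lowest-terms t) (ι-denominator t) quartic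
  where
  lowest-terms : ∀ t → ¬ (+ 2 ∣ ℚ.↥ t × + 2 ∣ ℚ.↧ t)
  lowest-terms (mkℚ _ _ coprime) (2∣p , 2∣q) with recompute coprime (∣⇒∣ᵤ 2∣p , ∣⇒∣ᵤ 2∣q)
  ... | ()

avoid : (f : ℕ → ℚ) → (∀ {i j} → f i ≡ f j → i ≡ j) → (l : List ℚ) → ∃ λ k → f k ∉ l
avoid f f-inj [] = 0 , λ ()
avoid f f-inj (x ∷ xs) with avoid f f-inj xs
... | k , fk∉xs with f k ℚ.≟ x
...   | no fk≢x  = k , λ { (here fk≡x) → fk≢x fk≡x ; (there fk∈xs) → fk∉xs fk∈xs }
...   | yes fk≡x with avoid (λ i → f (i ℕ.+ suc k)) (λ eq → ℕ.+-cancelʳ-≡ (suc k) _ _ (f-inj eq)) xs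
...     | i , fi∉xs = i ℕ.+ suc k ,
  λ { (here fi≡x) → ℕ.m+1+n≢n i (f-inj (trans fi≡x (sym fk≡x))) ; (there fi∈xs) → fi∉xs fi∈xs }

injective⇒infinitelyMany : ∀ {P : ℚ → Set} (f : ℕ → ℚ) → (∀ {i j} → f i ≡ f j → i ≡ j) →
                           (∀ k → P (f k)) → InfinitelyMany P
injective⇒infinitelyMany f f-inj Pf l with avoid f f-inj l
... | k , fk∉l = f k , fk∉l , Pf k

infinitelyManyTriples : ∀ {b} → b ≢ 0ℚ → 1ℚ ≢ b → IsSquare (1ℚ * b - 1ℚ) → IsSquare (b * b - 1ℚ) →
                        (∃₂ λ m n → Odd m × n ≢ 0ℤ × b * ι (bDen m n) ≡ ι (bNum m n)) →
                        InfinitelyMany (λ c → StrongD-1Triple 1ℚ b c)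
infinitelyManyTriples b≢0 1≢b 1b-1□ bb-1□ (m , n , m-odd , n≢0 , bD≡N) =
  injective⇒infinitelyMany c c-injective (triple (frac-unique N D≢0 bD≡N) b≢0 1≢b 1b-1□ bb-1□)
  where open Construction m n m-odd n≢0

proposition1p2 : (b : ℚ) → StrongD-1Pair 1ℚ b →
    InfinitelyMany (λ c → StrongD-1Triple 1ℚ b c)
proposition1p2 b (_ , b≢0 , 1≢b , 1b-1□@(s , s²≡b-1) , _ , bb-1□@(r , r²≡b²-1)) =
  infinitelyManyTriples b≢0 1≢b 1b-1□ bb-1□ (quartic⇒integral {b} (pair⇒quartic {b} {s} {r} s²≡b-1 r²≡b²-1 1≢b))
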